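{- Let $G$ be a connected graph with $m$ edges and $H$ an arbitrary graph. Then $\alpha(G\diamond H)=m\,\alpha(H)$.
   Context: For a simple graph $G$ with edges $e_1,\dots,e_m$ and a graph $H$, the edge corona product $G\diamond H$ is the graph obtained by taking one copy of $G$ and $m$ vertex-disjoint copies $H_1,\dots,H_m$ of $H$ and joining both end vertices of $e_i$ to every vertex of $H_i$, $1\le i\le m$. $\alpha$ denotes the independence number. -}

module Defs where

open import Data.Nat using (ℕ; _<ᵇ_)
open import Data.Bool using (Bool; true; false; if_then_else_; _∧_)
open import Data.Fin using (Fin; toℕ)
open import Data.List using (List; []; _∷_; length; concatMap; allFin; lookup)
open import Data.List.Relation.Unary.Unique.Propositional using (Unique)
open import Data.Product using (_×_; _,_; proj₁; proj₂; Σ; ∃-syntax)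
open import Data.Sum using (_⊎_; inj₁; inj₂)
open import Data.Empty using (⊥)
open import Data.List.Membership.Propositional using (_∈_)
open import Relation.Binary.PropositionalEquality using (_≡_)
open import Relation.Nullary using (¬_)
open import Data.Nat using (_≤_)

record Graph (n : ℕ) : Set where
  field
    adj    : Fin n → Fin n → Bool
    sym    : ∀ i j → adj i j ≡ adj j i
    irrefl : ∀ i → adj i i ≡ false
open Graph public

Adj : ∀ {n} → Graph n → Fin n → Fin n → Set
Adj G i j = adj G i j ≡ true

edges : ∀ {n} → Graph n → List (Fin n × Fin n)
edges {n} G =
  concatMap (λ i → concatMap (λ j →
    if adj G i j ∧ (toℕ i <ᵇ toℕ j) then (i , j) ∷ [] else []) (allFin n)) (allFin n)

numEdges : ∀ {n} → Graph n → ℕ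
numEdges G = length (edges G)

data Reachable {n : ℕ} (G : Graph n) : Fin n → Fin n → Set where
  here : ∀ {u} → Reachable G u u
  step : ∀ {u v w} → Adj G u v → Reachable G v w → Reachable G u w

Connected : ∀ {n} → Graph n → Set
Connected {n} G = ∀ (u v : Fin n) → Reachable G u v

Independent : {V : Set} → (V → V → Set) → List V → Set
Independent {V} R xs = Unique xs × (∀ (x y : V) → x ∈ xs → y ∈ xs → ¬ R x y)

IsIndependenceNumber : {V : Set} → (V → V → Set) → ℕ → Set
IsIndependenceNumber {V} R k =
  (Σ (List V) λ xs → Independent R xs × length xs ≡ k)
  × (∀ (xs : List V) → Independent R xs → length xs ≤ k)

-- Vertex type of the edge corona G ⋄ H: the vertices of G, plus for every edge index
-- e : Fin m a copy H_e of H (vertex (e , x) is vertex x of the copy H_e).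
CoronaV : ∀ {n k} → Graph n → Graph k → Set
CoronaV {n} {k} G H = Fin n ⊎ (Fin (numEdges G) × Fin k)

IsEndOf : ∀ {n} (G : Graph n) → Fin n → Fin (numEdges G) → Set
IsEndOf G u e = (u ≡ proj₁ (lookup (edges G) e)) ⊎ (u ≡ proj₂ (lookup (edges G) e))

CoronaAdj : ∀ {n k} (G : Graph n) (H : Graph k) → CoronaV G H → CoronaV G H → Set
CoronaAdj G H (inj₁ u) (inj₁ v) = Adj G u v
CoronaAdj G H (inj₁ u) (inj₂ (e , x)) = IsEndOf G u e
CoronaAdj G H (inj₂ (e , x)) (inj₁ u) = IsEndOf G u e
CoronaAdj G H (inj₂ (e , x)) (inj₂ (f , y)) = (e ≡ f) × Adj H x y

module Submission where

-- Lower bound: the m copies of a maximum independent set of H form an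
-- independent set of G ⋄ H (different copies are never adjacent).
--
-- Upper bound: since G has no isolated vertex, every vertex u of G is an end of
-- some edge, its owner.  The vertex set of G ⋄ H is partitioned into m blocks:
-- block e consists of the copy H_e together with the vertices of G owned by e.
-- In one block an independent set has at most a elements: a vertex u of G in
-- the block is adjacent to all of H_e and to every other vertex of G owned by
-- e (both are ends of e), so it is alone; otherwise the set lies inside H_e and
-- is an independent set of H.  A pigeonhole count over the blocks gives m·a.

open import Defs hiding (sym)
open import Level using (0ℓ)
open import Data.Bool using (Bool; true; T; _∧_; if_then_else_)
open import Data.Nat using (ℕ; zero; suc; _≤_; _<_; _+_; _*_; z≤n; s≤s; _≟_; _<ᵇ_)
open import Data.Nat.Properties
  using (≤-trans; ≤-refl; +-suc; +-mono-≤; ≤-pred; ≤∧≢⇒<; m≤n⇒m≤1+n; suc-injective; <⇒<ᵇ; <-cmp)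
open import Data.Fin using (Fin; toℕ) renaming (zero to fzero; suc to fsuc)
open import Data.Fin.Properties using (toℕ-injective; toℕ<n) renaming (_≟_ to _≟ᶠ_)
open import Data.List
  using (List; []; _∷_; length; map; filter; _++_; allFin; cartesianProductWith)
open import Data.List.Properties using (length-map; length-++; length-tabulate)
open import Data.List.Membership.Propositional using (_∈_; lose; find)
open import Data.List.Membership.Propositional.Properties
  using (∈-map⁻; ∈-filter⁻; ∈-concatMap⁺; ∈-concatMap⁻; ∈-allFin; ∈-lookup; ∈-cartesianProductWith⁻)
open import Data.List.Relation.Unary.All as All using (All)
open import Data.List.Relation.Unary.All.Properties using (map⁺)
open import Data.List.Relation.Unary.Any as Any using (here; there; any?)
open import Data.List.Relation.Unary.Any.Properties using (lookup-index)
open import Data.List.Relation.Unary.AllPairs using ([]; _∷_)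
open import Data.List.Relation.Unary.Unique.Propositional using (Unique)
open import Data.List.Relation.Unary.Unique.Propositional.Properties
  using (filter⁺; cartesianProductWith⁺; allFin⁺)
open import Data.List.Relation.Binary.Sublist.Propositional.Properties
  using (filter-⊆; length-mono-≤) renaming (filter⁺ to filter-⊆-filter)
open import Data.Product using (_×_; _,_; proj₁; proj₂; Σ; ∃)
open import Data.Sum using (inj₁; inj₂)
open import Data.Empty using (⊥-elim)
open import Relation.Binary using (tri<; tri≈; tri>)
open import Relation.Binary.PropositionalEquality
  using (_≡_; _≢_; refl; sym; trans; cong; cong₂; subst; module ≡-Reasoning)
open import Relation.Nullary using (¬_; yes; no)
open import Relation.Nullary.Negation using (contradiction)
open import Relation.Unary using (Pred; Decidable)
open import Relation.Unary.Properties using (∁?)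


module _ {A : Set} {P : Pred A 0ℓ} (P? : Decidable P) where

  length-filter-split : (S : List A) →
    length S ≡ length (filter P? S) + length (filter (∁? P?) S)
  length-filter-split [] = refl
  length-filter-split (x ∷ S) with P? x
  ... | yes _ = cong suc (length-filter-split S)
  ... | no  _ = trans (cong suc (length-filter-split S)) (sym (+-suc _ _))

  length-filter-filter : ∀ {Q : Pred A 0ℓ} (Q? : Decidable Q) (S : List A) →
    length (filter P? (filter Q? S)) ≤ length (filter P? S)
  length-filter-filter Q? S = length-mono-≤ (filter-⊆-filter P? P? (λ { refl p → p }) (filter-⊆ Q? S))

pigeonhole : ∀ {A : Set} (label : A → ℕ) (m a : ℕ) (S : List A) →
  All (λ s → label s < m) S →
  (∀ e → e < m → length (filter (λ s → label s ≟ e) S) ≤ a) →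
  length S ≤ m * a
pigeonhole label zero a [] _ _ = z≤n
pigeonhole label zero a (s ∷ S) (() All.∷ _) _
pigeonhole label (suc m) a S labels fibres
  rewrite length-filter-split (λ s → label s ≟ m) S =
  +-mono-≤ (fibres m ≤-refl) (pigeonhole label m a rest rest-labels rest-fibres)
  where
  top? : Decidable (λ s → label s ≡ m)
  top? s = label s ≟ m
  rest : List _
  rest = filter (∁? top?) S
  rest-labels : All (λ s → label s < m) rest
  rest-labels = All.tabulate λ s∈rest →
    let s∈S , s≢m = ∈-filter⁻ (∁? top?) {xs = S} s∈rest
    in ≤-pred (≤∧≢⇒< (All.lookup labels s∈S) (λ eq → s≢m (suc-injective eq)))
  rest-fibres : ∀ e → e < m → length (filter (λ s → label s ≟ e) rest) ≤ a
  rest-fibres e e<m =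
    ≤-trans (length-filter-filter (λ s → label s ≟ e) (∁? top?) S) (fibres e (m≤n⇒m≤1+n e<m))

unique-map : ∀ {A B : Set} (f : A → B) (xs : List A) →
  (∀ {x y} → x ∈ xs → y ∈ xs → f x ≡ f y → x ≡ y) →
  Unique xs → Unique (map f xs)
unique-map f [] _ [] = []
unique-map f (x ∷ xs) injective (x∉xs ∷ unique-xs) =
  map⁺ (All.tabulate λ y∈xs fx≡fy → All.lookup x∉xs y∈xs (injective (here refl) (there y∈xs) fx≡fy))
  ∷ unique-map f xs (λ x∈ y∈ → injective (there x∈) (there y∈)) unique-xs

unique-constant : ∀ {A : Set} (z : A) (xs : List A) →
  Unique xs → (∀ {y} → y ∈ xs → y ≡ z) → length xs ≤ 1
unique-constant z [] _ _ = z≤n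
unique-constant z (x ∷ []) _ _ = s≤s z≤n
unique-constant z (x ∷ y ∷ xs) ((x∉ All.∷ _) ∷ _) all-z =
  contradiction (trans (all-z (here refl)) (sym (all-z (there (here refl))))) x∉

length-cartesianProductWith : ∀ {A B C : Set} (f : A → B → C) (xs : List A) (ys : List B) →
  length (cartesianProductWith f xs ys) ≡ length xs * length ys
length-cartesianProductWith f [] ys = refl
length-cartesianProductWith f (x ∷ xs) ys = begin
  length (map (f x) ys ++ cartesianProductWith f xs ys)
    ≡⟨ length-++ (map (f x) ys) ⟩
  length (map (f x) ys) + length (cartesianProductWith f xs ys)
    ≡⟨ cong₂ _+_ (length-map (f x) ys) (length-cartesianProductWith f xs ys) ⟩
  length ys + length xs * length ys ∎
  where open ≡-Reasoning

adjacent-distinct : ∀ {n} (G : Graph n) {u v : Fin n} → Adj G u v → u ≢ v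
adjacent-distinct G {u} u~u refl with trans (sym u~u) (irrefl G u)
... | ()

guarded : ∀ {n} → Bool → Fin n × Fin n → List (Fin n × Fin n)
guarded b q = if b then q ∷ [] else []

guarded-∈ : ∀ {n} {b c : Bool} {q : Fin n × Fin n} → b ≡ true → T c → q ∈ guarded (b ∧ c) q
guarded-∈ {c = true} refl _ = here refl

∈-guarded : ∀ {n} (b c : Bool) {p q : Fin n × Fin n} → p ∈ guarded (b ∧ c) q → b ≡ true × p ≡ q
∈-guarded true true (here p≡q) = refl , p≡q

module _ {n : ℕ} (G : Graph n) where

  edge-∈-edges : ∀ {i j} → Adj G i j → toℕ i < toℕ j → (i , j) ∈ edges G
  edge-∈-edges {i} {j} i~j i<j =
    ∈-concatMap⁺ _ (lose (∈-allFin i) (∈-concatMap⁺ _ (lose (∈-allFin j) (guarded-∈ i~j (<⇒<ᵇ i<j)))))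

  edges-adjacent : ∀ {p} → p ∈ edges G → Adj G (proj₁ p) (proj₂ p)
  edges-adjacent {p} p∈edges with Any.satisfied (∈-concatMap⁻ _ {xs = allFin n} p∈edges)
  ... | i , p∈row with Any.satisfied (∈-concatMap⁻ _ {xs = allFin n} p∈row)
  ... | j , p∈entry with ∈-guarded (adj G i j) (toℕ i <ᵇ toℕ j) p∈entry
  ... | i~j , refl = i~j

  ends-adjacent : ∀ {u v e} → IsEndOf G u e → IsEndOf G v e → u ≢ v → Adj G u v
  ends-adjacent {e = e} (inj₁ refl) (inj₂ refl) _ = edges-adjacent (∈-lookup e)
  ends-adjacent {e = e} (inj₂ refl) (inj₁ refl) _ =
    trans (Graph.sym G _ _) (edges-adjacent (∈-lookup e))
  ends-adjacent (inj₁ refl) (inj₁ refl) u≢v = contradiction refl u≢v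
  ends-adjacent (inj₂ refl) (inj₂ refl) u≢v = contradiction refl u≢v

  incident-edge : ∀ {u w} → Adj G u w → Σ (Fin (numEdges G)) (IsEndOf G u)
  incident-edge {u} {w} u~w with <-cmp (toℕ u) (toℕ w)
  ... | tri< u<w _ _ = let p = edge-∈-edges u~w u<w in
    Any.index p , inj₁ (cong proj₁ (lookup-index p))
  ... | tri≈ _ u≡w _ = contradiction (toℕ-injective u≡w) (adjacent-distinct G u~w)
  ... | tri> _ _ w<u = let p = edge-∈-edges (trans (Graph.sym G w u) u~w) w<u in
    Any.index p , inj₂ (cong proj₂ (lookup-index p))

  -- In a connected graph with at least two vertices every vertex is an end of
  -- some edge: a walk to a different vertex starts with an edge.
  every-vertex-on-edge : Connected G → 2 ≤ n → (u : Fin n) → Σ (Fin (numEdges G)) (IsEndOf G u)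
  every-vertex-on-edge connected (s≤s (s≤s _)) u = first-edge (connected u (other u)) (other-≢ u)
    where
    other : Fin n → Fin n
    other fzero    = fsuc fzero
    other (fsuc _) = fzero
    other-≢ : ∀ u → u ≢ other u
    other-≢ fzero    ()
    other-≢ (fsuc _) ()
    first-edge : ∀ {v} → Reachable G u v → u ≢ v → Σ (Fin (numEdges G)) (IsEndOf G u)
    first-edge here           u≢u = contradiction refl u≢u
    first-edge (step u~w _) _ = incident-edge u~w

singleton-independent : ∀ {k} (H : Graph k) (x : Fin k) → Independent (Adj H) (x ∷ [])
singleton-independent H x =
  (All.[] ∷ []) , λ { _ _ (here refl) (here refl) x~x → adjacent-distinct H x~x refl }

module _ {n k : ℕ} (G : Graph n) (H : Graph k) where

  private
    m : ℕ
    m = numEdges G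

  all-copies : List (Fin k) → List (CoronaV G H)
  all-copies xs = cartesianProductWith (λ e x → inj₂ (e , x)) (allFin m) xs

  length-all-copies : (xs : List (Fin k)) → length (all-copies xs) ≡ m * length xs
  length-all-copies xs = trans (length-cartesianProductWith _ (allFin m) xs)
                               (cong (_* length xs) (length-tabulate {n = m} (λ e → e)))

  -- Vertices of distinct copies are never adjacent and within one copy the
  -- adjacency is that of H, so copying an independent set of H into all
  -- copies gives an independent set of G ⋄ H.
  all-copies-independent : ∀ {xs} → Independent (Adj H) xs → Independent (CoronaAdj G H) (all-copies xs)
  all-copies-independent {xs} (unique-xs , independent-xs) =
    cartesianProductWith⁺ _ (λ { refl → refl , refl }) (allFin⁺ m) unique-xs , no-edge
    where
    no-edge : ∀ s t → s ∈ all-copies xs → t ∈ all-copies xs → ¬ CoronaAdj G H s t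
    no-edge s t s∈ t∈ with ∈-cartesianProductWith⁻ _ (allFin m) xs s∈
                         | ∈-cartesianProductWith⁻ _ (allFin m) xs t∈
    ... | _ , x , _ , x∈xs , refl | _ , y , _ , y∈xs , refl =
      λ { (_ , x~y) → independent-xs x y x∈xs y∈xs x~y }

independent-filter : ∀ {V : Set} {R : V → V → Set} {P : Pred V 0ℓ} (P? : Decidable P) {xs : List V} →
  Independent R xs → Independent R (filter P? xs)
independent-filter P? {xs} (unique-xs , no-edge) =
  filter⁺ P? unique-xs ,
  λ x y x∈ y∈ → no-edge x y (proj₁ (∈-filter⁻ P? {xs = xs} x∈)) (proj₁ (∈-filter⁻ P? {xs = xs} y∈))

-- The upper bound α(G ⋄ H) ≤ m · α(H) holds whenever every vertex of G lies on
-- an edge; x₀ is any vertex of H (it guarantees α(H) ≥ 1).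
module CoronaUpperBound {n k : ℕ} (G : Graph n) (H : Graph k)
    (on-edge : (u : Fin n) → Σ (Fin (numEdges G)) (IsEndOf G u))
    (x₀ : Fin k) {a : ℕ} (α-bound : ∀ xs → Independent (Adj H) xs → length xs ≤ a) where

  private
    m : ℕ
    m = numEdges G
    V : Set
    V = CoronaV G H

  block : V → Fin m
  block (inj₁ u)       = proj₁ (on-edge u)
  block (inj₂ (e , _)) = e

  block-end : ∀ u → IsEndOf G u (block (inj₁ u))
  block-end u = proj₂ (on-edge u)

  InOneBlock : List V → Set
  InOneBlock F = ∀ {s t} → s ∈ F → t ∈ F → block s ≡ block t

  IsBase : Pred V 0ℓ
  IsBase s = ∃ λ u → s ≡ inj₁ u

  isBase? : Decidable IsBase
  isBase? (inj₁ u) = yes (u , refl)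
  isBase? (inj₂ _) = no λ ()

  -- A vertex u of G is adjacent to every other vertex of its block: to all of
  -- the copy H_e, and to the other vertices of G that are ends of e.
  base-vertex-alone : ∀ {u} F → Independent (CoronaAdj G H) F → InOneBlock F → inj₁ u ∈ F →
    ∀ {s} → s ∈ F → s ≡ inj₁ u
  base-vertex-alone {u} F (_ , no-edge) same u∈ {inj₁ v} v∈ with v ≟ᶠ u
  ... | yes refl = refl
  ... | no v≢u   = ⊥-elim (no-edge _ _ v∈ u∈ (ends-adjacent G (block-end v) u-end-of-v's-edge v≢u))
    where
    u-end-of-v's-edge : IsEndOf G u (block (inj₁ v))
    u-end-of-v's-edge = subst (IsEndOf G u) (sym (same v∈ u∈)) (block-end u)
  base-vertex-alone {u} F (_ , no-edge) same u∈ {inj₂ _} s∈ =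
    ⊥-elim (no-edge _ _ u∈ s∈ (subst (IsEndOf G u) (same u∈ s∈) (block-end u)))

  coordinate : V → Fin k
  coordinate (inj₁ _)       = x₀
  coordinate (inj₂ (_ , x)) = x

  copy-block-bound : ∀ F → Independent (CoronaAdj G H) F → InOneBlock F →
    (∀ {s} → s ∈ F → ¬ IsBase s) → length F ≤ a
  copy-block-bound F (unique-F , no-edge) same no-base =
    subst (_≤ a) (length-map coordinate F)
      (α-bound _ (unique-map coordinate F coordinate-injective unique-F , coordinates-independent))
    where
    coordinate-injective : ∀ {s t} → s ∈ F → t ∈ F → coordinate s ≡ coordinate t → s ≡ t
    coordinate-injective {inj₁ u} s∈ _ _ = ⊥-elim (no-base s∈ (u , refl))
    coordinate-injective {inj₂ _} {inj₁ u} _ t∈ _ = ⊥-elim (no-base t∈ (u , refl))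
    coordinate-injective {inj₂ _} {inj₂ _} s∈ t∈ refl with same s∈ t∈
    ... | refl = refl
    copy-adjacent : ∀ {s t} → s ∈ F → t ∈ F → Adj H (coordinate s) (coordinate t) → CoronaAdj G H s t
    copy-adjacent {inj₁ u} s∈ _ _ = ⊥-elim (no-base s∈ (u , refl))
    copy-adjacent {inj₂ _} {inj₁ u} _ t∈ _ = ⊥-elim (no-base t∈ (u , refl))
    copy-adjacent {inj₂ _} {inj₂ _} s∈ t∈ x~y = same s∈ t∈ , x~y
    coordinates-independent : ∀ x y → x ∈ map coordinate F → y ∈ map coordinate F → ¬ Adj H x y
    coordinates-independent x y x∈ y∈ x~y with ∈-map⁻ coordinate x∈ | ∈-map⁻ coordinate y∈
    ... | s , s∈ , refl | t , t∈ , refl = no-edge s t s∈ t∈ (copy-adjacent s∈ t∈ x~y)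

  α-positive : 1 ≤ a
  α-positive = α-bound _ (singleton-independent H x₀)

  block-bound : ∀ F → Independent (CoronaAdj G H) F → InOneBlock F → length F ≤ a
  block-bound F independent same with any? isBase? F
  ... | no no-base = copy-block-bound F independent same (λ s∈ base → no-base (lose s∈ base))
  ... | yes has-base with find has-base
  ...   | _ , u∈ , _ , refl =
    ≤-trans (unique-constant _ F (proj₁ independent) (base-vertex-alone F independent same u∈)) α-positive

  corona-upper-bound : ∀ S → Independent (CoronaAdj G H) S → length S ≤ m * a
  corona-upper-bound S independent =
    pigeonhole (λ s → toℕ (block s)) m a S (All.tabulate λ {s} _ → toℕ<n (block s)) fibre-bound
    where
    fibre-bound : ∀ e → e < m → length (filter (λ s → toℕ (block s) ≟ e) S) ≤ a
    fibre-bound e _ = block-bound _ (independent-filter in-fibre? independent) same-block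
      where
      in-fibre? : Decidable (λ s → toℕ (block s) ≡ e)
      in-fibre? s = toℕ (block s) ≟ e
      same-block : InOneBlock (filter in-fibre? S)
      same-block s∈ t∈ = toℕ-injective
        (trans (proj₂ (∈-filter⁻ in-fibre? {xs = S} s∈)) (sym (proj₂ (∈-filter⁻ in-fibre? {xs = S} t∈))))

open CoronaUpperBound using (corona-upper-bound)

mainTheorem15 : ∀ {n k} (G : Graph n) (H : Graph k) → Connected G → 2 ≤ n → 1 ≤ k
    → ∀ (a : ℕ) → IsIndependenceNumber (Adj H) a
    → IsIndependenceNumber (CoronaAdj G H) (numEdges G * a)
mainTheorem15 {k = zero} G H _ _ () _ _
mainTheorem15 {k = suc _} G H connected n≥2 _ a ((xs , xs-independent , length-xs≡a) , α-bound) =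
  ( all-copies G H xs
  , all-copies-independent G H xs-independent
  , trans (length-all-copies G H xs) (cong (numEdges G *_) length-xs≡a) )
  , corona-upper-bound G H (every-vertex-on-edge G connected n≥2) fzero α-bound
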